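{- There is a constant $C>0$ such that for all integers $N\ge 1$ and $M\ge 4$, there is a 2D SLP of size at most $C(\log N + \log M)$ deriving $C_{N,M}$ (for $N,M\ge 2$).
   Context: Alphabet $\{0,1,\$\}$; logarithms base $2$. A 2D SLP consists of nonterminals, a starting nonterminal, and for each nonterminal one production whose right-hand side is a character, a horizontal concatenation of two nonterminals deriving strings of equal height, or a vertical concatenation of two nonterminals deriving strings of equal width, with acyclic dependency; its size is the total number of symbols on right-hand sides. For $K=2^k$, $\mathsf{Bin}_K$ is the $K\times(k+2)$ 2D string whose $i$-th row is $\$$, the $k$-bit binary representation of $i-1$, $\$$; $\mathsf{ShiftBin}_K$ is the $2K\times K(k+2)$ 2D string such that for every $j\in[0..K-1]$ the substring in rows $j+1..j+K$ and columns $j(k+2)+1..(j+1)(k+2)$ equals $\mathsf{Bin}_K$ and all other entries are $0$. For $N,M$ with $M\ge 4$, let $M'=2^{m}$ be the largest power of two with $M'(\log M'+2)\le M/2$, let $W=M'(\log M'+2)$ (the width of $\mathsf{ShiftBin}_{M'}$), $q_1=\lfloor N/(2M')\rfloor$ and $q_2=\max\{0,\lfloor (N-M')/(2M')\rfloor\}$. $C_{N,M}$ is the $N\times M$ 2D string consisting of: a left block of width $W$ whose rows $1..2M'q_1$ are $q_1$ vertically concatenated copies of $\mathsf{ShiftBin}_{M'}$ and whose remaining rows are $0$; to its right a block of width $W$ whose rows $M'+1..M'+2M'q_2$ are $q_2$ vertically concatenated copies of $\mathsf{ShiftBin}_{M'}$ and whose remaining entries are $0$; and to the right of these, all-$0$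 columns completing the width to $M$. -}

module Defs where

open import Data.Nat using (ℕ; zero; suc; _+_; _*_; _∸_; _^_; _≤_; _<_; _≟_; _<ᵇ_; _≤ᵇ_; _/_; _%_; ⌊_/2⌋)
open import Data.Nat.Properties using (m^n≢0)
open import Data.Bool using (Bool; true; false; if_then_else_; _∧_; _∨_)
open import Data.Fin using (Fin; toℕ)
open import Data.Vec using (Vec; []; _∷_; _∷ʳ_; lookup; tabulate; zipWith; _++_)
open import Data.Maybe using (Maybe; just; nothing)
open import Data.Product using (Σ; _×_)
open import Relation.Nullary using (yes; no)
open import Relation.Binary.PropositionalEquality using (_≡_; subst)

data Sym : Set where
  s0 s1 s$ : Sym

record Pic : Set where
  constructor mkPic
  field
    height : ℕ
    width  : ℕ
    cells  : Vec (Vec Sym width) height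
open Pic public

-- Nonterminals are numbered in a topological order of the
-- (acyclic) dependency relation: the rule of nonterminal number k may
-- only refer to nonterminals 0..k-1.  Every acyclic 2D SLP can be so
-- numbered.  The start nonterminal is arbitrary.

data Rule (n : ℕ) : Set where
  char : Sym → Rule n
  hcat : Fin n → Fin n → Rule n
  vcat : Fin n → Fin n → Rule n

data Prog : ℕ → Set where
  []   : Prog 0
  _▷_  : ∀ {n} → Prog n → Rule n → Prog (suc n)

-- size = total number of symbols on right-hand sides
ruleSize : ∀ {n} → Rule n → ℕ
ruleSize (char _)   = 1
ruleSize (hcat _ _) = 2
ruleSize (vcat _ _) = 2

size : ∀ {n} → Prog n → ℕ
size []      = 0
size (p ▷ r) = size p + ruleSize r

-- semantics of a rule given the derived strings of earlier nonterminals
-- (nothing = the side condition on heights/widths is violated)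
hcatPic : Pic → Pic → Maybe Pic
hcatPic (mkPic h₁ w₁ c₁) (mkPic h₂ w₂ c₂) with h₁ ≟ h₂
... | yes eq = just (mkPic h₂ (w₁ + w₂) (zipWith _++_ (subst (Vec (Vec Sym w₁)) eq c₁) c₂))
... | no _   = nothing

vcatPic : Pic → Pic → Maybe Pic
vcatPic (mkPic h₁ w₁ c₁) (mkPic h₂ w₂ c₂) with w₁ ≟ w₂
... | yes eq = just (mkPic (h₁ + h₂) w₂ (subst (λ w → Vec (Vec Sym w) h₁) eq c₁ ++ c₂))
... | no _   = nothing

bind2 : Maybe Pic → Maybe Pic → (Pic → Pic → Maybe Pic) → Maybe Pic
bind2 (just a) (just b) f = f a b
bind2 _        _        _ = nothing

evalRule : ∀ {n} → Vec (Maybe Pic) n → Rule n → Maybe Pic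
evalRule v (char a)   = just (mkPic 1 1 ((a ∷ []) ∷ []))
evalRule v (hcat i j) = bind2 (lookup v i) (lookup v j) hcatPic
evalRule v (vcat i j) = bind2 (lookup v i) (lookup v j) vcatPic

eval : ∀ {n} → Prog n → Vec (Maybe Pic) n
eval []      = []
eval (p ▷ r) = let v = eval p in v ∷ʳ evalRule v r

Derives : ∀ {n} → Prog n → Fin n → Pic → Set
Derives p s P = lookup (eval p) s ≡ just P

-- Bin_K, ShiftBin_K, C_{N,M}  (all indices 0-based here; the paper is
-- 1-based: paper row i = our row i-1, etc.)

shiftR : ℕ → ℕ → ℕ
shiftR r zero    = r
shiftR r (suc i) = shiftR ⌊ r /2⌋ i

bit : ℕ → ℕ → Sym
bit r i = if (shiftR r i % 2) ≤ᵇ 0 then s0 else s1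

-- Bin_{2^k}: entry at row r ∈ [0..2^k-1], column c ∈ [0..k+1].
-- Column 0 and column k+1 are $, columns 1..k are the k-bit binary
-- representation of r, most significant bit first.
binEntry : (k r c : ℕ) → Sym
binEntry k r c =
  if (c ≤ᵇ 0) ∨ (suc k ≤ᵇ c) then s$ else bit r (k ∸ c)

-- ShiftBin_{2^k}: entry at row r ∈ [0..2^{k+1}-1], column c ∈ [0..2^k(k+2)-1].
-- Block j = c / (k+2) occupies rows j..j+2^k-1 with a copy of Bin_{2^k}.
shiftBinEntry : (k r c : ℕ) → Sym
shiftBinEntry k r c =
  let j  = c / suc (suc k)
      c' = c % suc (suc k)
  in if (j ≤ᵇ r) ∧ (r <ᵇ j + 2 ^ k) then binEntry k (r ∸ j) c' else s0

-- m is the exponent of M' = 2^m: the largest m with 2^m (m+2) ≤ M/2.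
-- (For integers, x ≤ M/2 iff x ≤ ⌊M/2⌋.)
IsMaxExp : (M m : ℕ) → Set
IsMaxExp M m = (2 ^ m * (m + 2) ≤ M / 2) × (∀ m' → 2 ^ m' * (m' + 2) ≤ M / 2 → m' ≤ m)

cEntry : (N M m r c : ℕ) → Sym
cEntry N M m r c =
  let K  = 2 ^ m
      W  = K * (m + 2)
      q₁ = N / (2 ^ suc m)
      q₂ = (N ∸ K) / (2 ^ suc m)      -- = max{0, ⌊(N-M')/(2M')⌋}
  in if c <ᵇ W then
       (if r <ᵇ 2 * K * q₁
          then shiftBinEntry m (_%_ r (2 ^ suc m) {{m^n≢0 2 (suc m)}}) c
          else s0)
     else if c <ᵇ W + W then
       (if (K ≤ᵇ r) ∧ (r <ᵇ K + 2 * K * q₂)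
          then shiftBinEntry m (_%_ (r ∸ K) (2 ^ suc m) {{m^n≢0 2 (suc m)}}) (c ∸ W)
          else s0)
     else s0
  where instance _ = m^n≢0 2 (suc m)

CPic : (N M m : ℕ) → Pic
CPic N M m = mkPic N M (tabulate λ r → tabulate λ c → cEntry N M m (toℕ r) (toℕ c))

-- C_{N,M} is assembled from a bounded number of pieces by horizontal and vertical
-- concatenation.  Repeating a 2D string q times along an axis takes O(log q) rules
-- (one doubling per binary digit of q); this yields every all-zero rectangle and the
-- q₁ and q₂ stacked copies of ShiftBin_{M'}.  The digit block of Bin_{2^(k+1)} is
-- that of Bin_{2^k} twice, the upper copy preceded by a column of 0s and the lower one
-- by a column of 1s, so Bin_{M'} takes m steps of constant cost if the constant
-- columns are doubled alongside.  Block j + 2^t of ShiftBin is block j moved 2^t rows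
-- down, so ShiftBin_{M'} takes m further doubling steps.  The total size is
-- O(m + log N + log M), and m ≤ log M.
module Submission where

open import Defs
open import Data.Bool using (true; false; if_then_else_; _∧_)
open import Data.Bool.Properties using (if-float; T-≡; ∧-zeroʳ)
open import Data.Fin using (Fin; fromℕ; inject₁; toℕ)
open import Data.Fin.Properties using (toℕ<n)
open import Data.Maybe using (just)
open import Data.Nat
  using (ℕ; zero; suc; _+_; _*_; _∸_; _^_; _/_; _%_; _⊓_; ⌊_/2⌋; ⌈_/2⌉; _≤_; _<_; _<ᵇ_; _≤ᵇ_; _<?_; _≤?_;
         z≤n; s≤s; z<s; NonZero)
open import Data.Nat.Divisibility using (divides)
open import Data.Nat.DivMod
  using (0/n≡0; m/n*n≤m; m<n⇒m/n≡0; m<n*o⇒m/o<n; /-monoˡ-≤; +-distrib-/-∣ˡ; m*n/n≡m; [m+kn]%n≡m%n;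
         m<n⇒m%n≡m; m≤n⇒[n∸m]%m≡n%m; m*n≤o⇒[o∸m*n]%n≡o%n)
open import Data.Nat.Logarithm using (⌊log₂_⌋; ⌊log₂⌋-mono-≤; ⌊log₂[2^n]⌋≡n)
open import Data.Nat.Properties
open import Data.Nat.Tactic.RingSolver using (solve-∀)
open import Data.Product using (Σ; _×_; _,_)
open import Data.Sum using (_⊎_; inj₁; inj₂)
open import Data.Vec using (Vec; []; _∷_; _∷ʳ_; lookup; zipWith; _++_; tabulate)
open import Data.Vec.Properties using (tabulate-cong)
open import Function using (_∘_)
open import Function.Bundles using (Equivalence)
open import Relation.Binary.Construct.Closure.ReflexiveTransitive using (Star; ε; _◅_; _◅◅_)
open import Relation.Binary.PropositionalEquality
open import Relation.Nullary using (yes; no; contradiction)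
open import Relation.Nullary.Reflects using (ofʸ)

<ᵇ-true : ∀ {m n} → m < n → (m <ᵇ n) ≡ true
<ᵇ-true m<n = Equivalence.to T-≡ (<⇒<ᵇ m<n)

<ᵇ-false : ∀ {m n} → n ≤ m → (m <ᵇ n) ≡ false
<ᵇ-false {m} {n} n≤m with m <ᵇ n | <ᵇ-reflects-< m n
... | true  | ofʸ m<n = contradiction n≤m (<⇒≱ m<n)
... | false | _       = refl

≤ᵇ-true : ∀ {m n} → m ≤ n → (m ≤ᵇ n) ≡ true
≤ᵇ-true {zero}  _   = refl
≤ᵇ-true {suc m} m<n = <ᵇ-true m<n

≤ᵇ-false : ∀ {m n} → n < m → (m ≤ᵇ n) ≡ false
≤ᵇ-false {suc m} (s≤s n≤m) = <ᵇ-false n≤m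

<ᵇ-+ : ∀ d m n → (d + m <ᵇ d + n) ≡ (m <ᵇ n)
<ᵇ-+ zero    m n = refl
<ᵇ-+ (suc d) m n = <ᵇ-+ d m n

≤ᵇ-+ : ∀ d m n → (d + m ≤ᵇ d + n) ≡ (m ≤ᵇ n)
≤ᵇ-+ zero    m n = refl
≤ᵇ-+ (suc d) m n = trans (<ᵇ-suc (d + m) (d + n)) (≤ᵇ-+ d m n)
  where
  <ᵇ-suc : ∀ x y → (x <ᵇ suc y) ≡ (x ≤ᵇ y)
  <ᵇ-suc zero    y = refl
  <ᵇ-suc (suc x) y = refl

if-true : ∀ {A : Set} {b} {x y : A} → b ≡ true → (if b then x else y) ≡ x
if-true refl = refl

if-false : ∀ {A : Set} {b} {x y : A} → b ≡ false → (if b then x else y) ≡ y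
if-false refl = refl

n+n≡2*n : ∀ n → n + n ≡ 2 * n
n+n≡2*n n = cong (n +_) (sym (+-identityʳ n))

m*n+m≡m*[1+n] : ∀ m n → m * n + m ≡ m * suc n
m*n+m≡m*[1+n] m n = trans (+-comm (m * n) m) (sym (*-suc m n))

⌊m+2n/2⌋≡⌊m/2⌋+n : ∀ m n → ⌊ m + 2 * n /2⌋ ≡ ⌊ m /2⌋ + n
⌊m+2n/2⌋≡⌊m/2⌋+n zero          n = trans (cong ⌊_/2⌋ (sym (n+n≡2*n n))) (sym (n≡⌊n+n/2⌋ n))
⌊m+2n/2⌋≡⌊m/2⌋+n (suc zero)    n = trans (cong (λ x → ⌊ suc x /2⌋) (sym (n+n≡2*n n))) (⌊1+n+n/2⌋≡n n)
  where
  ⌊1+n+n/2⌋≡n : ∀ n → ⌊ suc (n + n) /2⌋ ≡ n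
  ⌊1+n+n/2⌋≡n zero    = refl
  ⌊1+n+n/2⌋≡n (suc n) = cong suc (trans (cong ⌊_/2⌋ (+-suc n n)) (⌊1+n+n/2⌋≡n n))
⌊m+2n/2⌋≡⌊m/2⌋+n (suc (suc m)) n = cong suc (⌊m+2n/2⌋≡⌊m/2⌋+n m n)

m<2n⇒⌊m/2⌋<n : ∀ m n → m < 2 * n → ⌊ m /2⌋ < n
m<2n⇒⌊m/2⌋<n m n m<2n = *-cancelˡ-< 2 ⌊ m /2⌋ n (≤-<-trans 2⌊m/2⌋≤m m<2n)
  where
  open ≤-Reasoning
  2⌊m/2⌋≤m : 2 * ⌊ m /2⌋ ≤ m
  2⌊m/2⌋≤m = begin
    2 * ⌊ m /2⌋       ≡⟨ n+n≡2*n ⌊ m /2⌋ ⟨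
    ⌊ m /2⌋ + ⌊ m /2⌋ ≤⟨ +-monoʳ-≤ ⌊ m /2⌋ (⌊n/2⌋≤⌈n/2⌉ m) ⟩
    ⌊ m /2⌋ + ⌈ m /2⌉ ≡⟨ ⌊n/2⌋+⌈n/2⌉≡n m ⟩
    m                 ∎

data Parity : ℕ → Set where
  even : ∀ h → Parity (2 * h)
  odd  : ∀ h → Parity (suc (2 * h))

parity : ∀ n → Parity n
parity zero = even 0
parity (suc n) with parity n
... | even h = odd h
... | odd  h = subst Parity (*-suc 2 h) (even (suc h))

n<2^[1+⌊log₂n⌋] : ∀ n → n < 2 ^ suc ⌊log₂ n ⌋
n<2^[1+⌊log₂n⌋] n with n <? 2 ^ suc ⌊log₂ n ⌋
... | yes n<2^ = n<2^
... | no  n≮2^ = contradiction (subst (_≤ ⌊log₂ n ⌋) (⌊log₂[2^n]⌋≡n _) (⌊log₂⌋-mono-≤ (≮⇒≥ n≮2^)))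
                               (n≮n ⌊log₂ n ⌋)

bits : ℕ → ℕ
bits n = suc ⌊log₂ n ⌋

<2^bits : ∀ {m n} → m ≤ n → m < 2 ^ bits n
<2^bits {n = n} m≤n = ≤-<-trans m≤n (n<2^[1+⌊log₂n⌋] n)

-- Grids

-- A 2D string is handled through its entry function (0-based row, column).
Grid : Set
Grid = ℕ → ℕ → Sym

picture : ℕ → ℕ → Grid → Pic
picture h w F = mkPic h w (tabulate λ r → tabulate λ c → F (toℕ r) (toℕ c))

constant : Sym → Grid
constant a _ _ = a

_⟨_⟩_ : ∀ {A : Set} → (ℕ → A) → ℕ → (ℕ → A) → ℕ → A
(f ⟨ a ⟩ g) i = if i <ᵇ a then f i else g (i ∸ a)

above : ℕ → Grid → Grid → Grid
above a F G = F ⟨ a ⟩ G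

beside : ℕ → Grid → Grid → Grid
beside a F G r = F r ⟨ a ⟩ G r

⟨⟩-< : ∀ {A : Set} {i a} (f g : ℕ → A) → i < a → (f ⟨ a ⟩ g) i ≡ f i
⟨⟩-< {i = i} {a} f g i<a = cong (λ b → if b then f i else g (i ∸ a)) (<ᵇ-true i<a)

⟨⟩-≥ : ∀ {A : Set} {i a} (f g : ℕ → A) → a ≤ i → (f ⟨ a ⟩ g) i ≡ g (i ∸ a)
⟨⟩-≥ {i = i} {a} f g a≤i = cong (λ b → if b then f i else g (i ∸ a)) (<ᵇ-false a≤i)

above-< : ∀ {a r} F G c → r < a → above a F G r c ≡ F r c
above-< F G c r<a = cong-app (⟨⟩-< F G r<a) c

above-≥ : ∀ {a r} F G c → a ≤ r → above a F G r c ≡ G (r ∸ a) c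
above-≥ F G c a≤r = cong-app (⟨⟩-≥ F G a≤r) c

beside-< : ∀ {a c} F G r → c < a → beside a F G r c ≡ F r c
beside-< F G r c<a = ⟨⟩-< (F r) (G r) c<a

beside-≥ : ∀ {a c} F G r → a ≤ c → beside a F G r c ≡ G r (c ∸ a)
beside-≥ F G r a≤c = ⟨⟩-≥ (F r) (G r) a≤c

tabulate-⟨⟩ : ∀ {A : Set} a b (f g : ℕ → A) →
              tabulate {n = a} (f ∘ toℕ) ++ tabulate {n = b} (g ∘ toℕ) ≡ tabulate ((f ⟨ a ⟩ g) ∘ toℕ)
tabulate-⟨⟩ zero    b f g = refl
tabulate-⟨⟩ (suc a) b f g = cong (f 0 ∷_) (tabulate-⟨⟩ a b (f ∘ suc) g)

picture-cong : ∀ h w {F G : Grid} → (∀ r c → r < h → c < w → F r c ≡ G r c) → picture h w F ≡ picture h w G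
picture-cong h w F≗G =
  cong (mkPic h w) (tabulate-cong λ r → tabulate-cong λ c → F≗G (toℕ r) (toℕ c) (toℕ<n r) (toℕ<n c))

hcatPic-picture : ∀ h a b F G → hcatPic (picture h a F) (picture h b G) ≡ just (picture h (a + b) (beside a F G))
hcatPic-picture h a b F G rewrite ≟-diag (refl {x = h}) = cong (just ∘ mkPic h (a + b)) (rows h {F} {G})
  where
  rows : ∀ h {F G} → zipWith _++_ (picture h a F .cells) (picture h b G .cells) ≡ picture h (a + b) (beside a F G) .cells
  rows zero            = refl
  rows (suc h) {F} {G} = cong₂ _∷_ (tabulate-⟨⟩ a b (F 0) (G 0)) (rows h {F ∘ suc} {G ∘ suc})

vcatPic-picture : ∀ a b w F G → vcatPic (picture a w F) (picture b w G) ≡ just (picture (a + b) w (above a F G))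
vcatPic-picture a b w F G rewrite ≟-diag (refl {x = w}) =
  cong (just ∘ mkPic (a + b) w)
       (trans (tabulate-⟨⟩ a b (λ r → tabulate (F r ∘ toℕ)) (λ r → tabulate (G r ∘ toℕ)))
              (tabulate-cong λ r → sym (if-float (λ f → tabulate (f ∘ toℕ)) (toℕ r <ᵇ a))))

-- Growing straight-line programs

record SLP : Set where
  constructor ⟪_⟫
  field
    {nonterminals} : ℕ
    rules          : Prog nonterminals
open SLP

slpSize : SLP → ℕ
slpSize S = size (rules S)

_▶_ : (S : SLP) → Rule (nonterminals S) → SLP
S ▶ r = ⟪ rules S ▷ r ⟫

data _↝_ (S : SLP) : SLP → Set where
  add : ∀ r → S ↝ (S ▶ r)

_⊑_ : SLP → SLP → Set
_⊑_ = Star _↝_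

record Derivable (S : SLP) (h w : ℕ) (F : Grid) : Set where
  constructor derivable
  field
    start   : Fin (nonterminals S)
    derives : Derives (rules S) start (picture h w F)

-- SLPs derive only nonempty 2D strings; pieces with a zero dimension need no nonterminal.
data Available (S : SLP) (h w : ℕ) (F : Grid) : Set where
  empty   : h ≡ 0 ⊎ w ≡ 0 → Available S h w F
  derived : Derivable S h w F → Available S h w F

lookup-∷ʳ-inject₁ : ∀ {A : Set} {n} (v : Vec A n) x i → lookup (v ∷ʳ x) (inject₁ i) ≡ lookup v i
lookup-∷ʳ-inject₁ (y ∷ v) x Fin.zero    = refl
lookup-∷ʳ-inject₁ (y ∷ v) x (Fin.suc i) = lookup-∷ʳ-inject₁ v x i

lookup-∷ʳ-fromℕ : ∀ {A : Set} {n} (v : Vec A n) x → lookup (v ∷ʳ x) (fromℕ n) ≡ x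
lookup-∷ʳ-fromℕ []      x = refl
lookup-∷ʳ-fromℕ (y ∷ v) x = lookup-∷ʳ-fromℕ v x

derivable-↝ : ∀ {S T h w F} → S ↝ T → Derivable S h w F → Derivable T h w F
derivable-↝ {⟪ p ⟫} (add r) (derivable s d) = derivable (inject₁ s) (trans (lookup-∷ʳ-inject₁ (eval p) _ s) d)

derivable-⊑ : ∀ {S T h w F} → S ⊑ T → Derivable S h w F → Derivable T h w F
derivable-⊑ ε        d = d
derivable-⊑ (e ◅ es) d = derivable-⊑ es (derivable-↝ e d)

wk : ∀ {S T h w F} → S ⊑ T → Available S h w F → Available T h w F
wk es (empty z)   = empty z
wk es (derived d) = derived (derivable-⊑ es d)

Available-cong : ∀ {S h w F G} → (∀ r c → r < h → c < w → F r c ≡ G r c) → Available S h w F → Available S h w G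
Available-cong F≗G (empty z) = empty z
Available-cong {h = h} {w} F≗G (derived (derivable s d)) =
  derived (derivable s (trans d (cong just (picture-cong h w F≗G))))

Available-resize : ∀ {S h h′ w w′ F} → h ≡ h′ → w ≡ w′ → Available S h w F → Available S h′ w′ F
Available-resize refl refl X = X

-- Results obtained earlier stay available in every extension (wk): this is how
-- nonterminals get shared.
record Extension (S : SLP) (k : ℕ) (P : SLP → Set) : Set where
  constructor extension
  field
    {result}  : SLP
    extends   : S ⊑ result
    cost      : slpSize result ≤ slpSize S + k
    satisfies : P result

pure : ∀ {S k P} → P S → Extension S k P
pure {S} {k} x = extension ε (m≤m+n (slpSize S) k) x

_>>=_ : ∀ {S a b P Q} → Extension S a P → (∀ {T} → S ⊑ T × P T → Extension T b Q) → Extension S (a + b) Q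
_>>=_ {S} {a} {b} (extension e c x) f with f (e , x)
... | extension e′ c′ y =
  extension (e ◅◅ e′) (≤-trans c′ (≤-trans (+-monoˡ-≤ b c) (≤-reflexive (+-assoc (slpSize S) a b)))) y

map : ∀ {S k P Q} → (∀ {T} → P T → Q T) → Extension S k P → Extension S k Q
map f (extension e c x) = extension e c (f x)

relax : ∀ {S a b P} → a ≤ b → Extension S a P → Extension S b P
relax {S} a≤b (extension e c x) = extension e (≤-trans c (+-monoʳ-≤ (slpSize S) a≤b)) x

addRule : ∀ S r {h w F} → evalRule (eval (rules S)) r ≡ just (picture h w F) →
          Extension S (ruleSize r) (λ T → Derivable T h w F)
addRule S r eq =
  extension (add r ◅ ε) ≤-refl (derivable (fromℕ _) (trans (lookup-∷ʳ-fromℕ (eval (rules S)) _) eq))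

letter : ∀ S a → Extension S 1 (λ T → Available T 1 1 (constant a))
letter S a = map derived (addRule S (char a) refl)

extractSLP : ∀ {h w F k} → 1 ≤ h → 1 ≤ w → Extension ⟪ [] ⟫ k (λ T → Available T h w F) →
             Σ ℕ λ n → Σ (Prog n) λ p → Σ (Fin n) λ s → Derives p s (picture h w F) × size p ≤ k
extractSLP _       _       (extension {T} _ size≤k (derived (derivable s d))) = nonterminals T , rules T , s , d , size≤k
extractSLP (s≤s _) _       (extension _ _ (empty (inj₁ ())))
extractSLP _       (s≤s _) (extension _ _ (empty (inj₂ ())))

catBeside : ∀ {S h a b F G} → Available S h a F → Available S h b G →
            Extension S 2 (λ T → Available T h (a + b) (beside a F G))
catBeside (empty (inj₁ h≡0)) _                   = pure (empty (inj₁ h≡0))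
catBeside (empty (inj₂ refl)) Y                  = pure Y
catBeside _                   (empty (inj₁ h≡0)) = pure (empty (inj₁ h≡0))
catBeside {a = a} {F = F} {G} X (empty (inj₂ refl)) =
  pure (Available-resize refl (sym (+-identityʳ a)) (Available-cong (λ r c _ c<a → sym (beside-< F G r c<a)) X))
catBeside {S} {h} {a} {b} {F} {G} (derived (derivable i di)) (derived (derivable j dj)) =
  map derived (addRule S (hcat i j) (trans (cong₂ (λ x y → bind2 x y hcatPic) di dj) (hcatPic-picture h a b F G)))

catAbove : ∀ {S a b w F G} → Available S a w F → Available S b w G →
           Extension S 2 (λ T → Available T (a + b) w (above a F G))
catAbove (empty (inj₂ w≡0)) _                   = pure (empty (inj₂ w≡0))
catAbove (empty (inj₁ refl)) Y                  = pure Y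
catAbove _                   (empty (inj₂ w≡0)) = pure (empty (inj₂ w≡0))
catAbove {a = a} {F = F} {G} X (empty (inj₁ refl)) =
  pure (Available-resize (sym (+-identityʳ a)) refl (Available-cong (λ r c r<a _ → sym (above-< F G c r<a)) X))
catAbove {S} {a} {b} {w} {F} {G} (derived (derivable i di)) (derived (derivable j dj)) =
  map derived (addRule S (vcat i j) (trans (cong₂ (λ x y → bind2 x y vcatPic) di dj) (vcatPic-picture a b w F G)))

-- Repetition along an axis

data Axis : Set where
  vertical horizontal : Axis

Along : Axis → SLP → ℕ → ℕ → Grid → Set
Along vertical   S l t = Available S l t
Along horizontal S l t = Available S t l

join : Axis → ℕ → Grid → Grid → Grid
join vertical   = above
join horizontal = beside

periodic : Axis → (p : ℕ) .{{_ : NonZero p}} → Grid → Grid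
periodic vertical   p F r c = F (r % p) c
periodic horizontal p F r c = F r (c % p)

catAlong : ∀ d {S a b t F G} → Along d S a t F → Along d S b t G →
           Extension S 2 (λ T → Along d T (a + b) t (join d a F G))
catAlong vertical   = catAbove
catAlong horizontal = catBeside

Along-empty : ∀ d {S t F} → Along d S 0 t F
Along-empty vertical   = empty (inj₁ refl)
Along-empty horizontal = empty (inj₂ refl)

Along-wk : ∀ d {S T l t F} → S ⊑ T → Along d S l t F → Along d T l t F
Along-wk vertical   = wk
Along-wk horizontal = wk

Along-cong : ∀ d {S l t F G} → (∀ r c → F r c ≡ G r c) → Along d S l t F → Along d S l t G
Along-cong vertical   F≗G = Available-cong λ r c _ _ → F≗G r c
Along-cong horizontal F≗G = Available-cong λ r c _ _ → F≗G r c

⟨⟩-periodic : ∀ {A : Set} {p} .{{_ : NonZero p}} n (f : ℕ → A) i →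
              ((f ∘ (_% p)) ⟨ n * p ⟩ (f ∘ (_% p))) i ≡ f (i % p)
⟨⟩-periodic {p = p} n f i with i <? n * p
... | yes i<np = ⟨⟩-< (f ∘ (_% p)) (f ∘ (_% p)) i<np
... | no  i≮np = trans (⟨⟩-≥ (f ∘ (_% p)) (f ∘ (_% p)) (≮⇒≥ i≮np))
                       (cong f (m*n≤o⇒[o∸m*n]%n≡o%n n (≮⇒≥ i≮np)))

⟨⟩-periodic-cons : ∀ {A : Set} p .{{_ : NonZero p}} (f : ℕ → A) i → (f ⟨ p ⟩ (f ∘ (_% p))) i ≡ f (i % p)
⟨⟩-periodic-cons p f i with i <? p
... | yes i<p = trans (⟨⟩-< f (f ∘ (_% p)) i<p) (cong f (sym (m<n⇒m%n≡m i<p)))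
... | no  i≮p = trans (⟨⟩-≥ f (f ∘ (_% p)) (≮⇒≥ i≮p)) (cong f (m≤n⇒[n∸m]%m≡n%m (≮⇒≥ i≮p)))

join-periodic : ∀ d {p} .{{_ : NonZero p}} n F r c →
                join d (n * p) (periodic d p F) (periodic d p F) r c ≡ periodic d p F r c
join-periodic vertical   n F r c = cong-app (⟨⟩-periodic n F r) c
join-periodic horizontal n F r c = ⟨⟩-periodic n (F r) c

join-periodic-cons : ∀ d p .{{_ : NonZero p}} F r c → join d p F (periodic d p F) r c ≡ periodic d p F r c
join-periodic-cons vertical   p F r c = cong-app (⟨⟩-periodic-cons p F r) c
join-periodic-cons horizontal p F r c = ⟨⟩-periodic-cons p (F r) c

Along-join-periodic : ∀ d {S p t F} .{{_ : NonZero p}} n →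
                       Along d S (n * p + n * p) t (join d (n * p) (periodic d p F) (periodic d p F)) →
                       Along d S (2 * n * p) t (periodic d p F)
Along-join-periodic d {S} {p} {t} {F} n X =
  subst (λ l → Along d S l t (periodic d p F)) (trans (n+n≡2*n (n * p)) (sym (*-assoc 2 n p)))
        (Along-cong d (join-periodic d n F) X)

repeat : ∀ d {S p t F} .{{_ : NonZero p}} k q → q < 2 ^ k → Along d S p t F →
         Extension S (4 * k) (λ T → Along d T (q * p) t (periodic d p F))
repeat d zero zero    _        X = pure (Along-empty d)
repeat d zero (suc q) (s≤s ()) X
repeat d {p = p} {F = F} (suc k) q q<2^[1+k] X with parity q
... | even h = relax (≤-trans (+-monoʳ-≤ (4 * k) (m≤m+n 2 2)) (≤-reflexive (m*n+m≡m*[1+n] 4 k))) do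
  _ , Y ← repeat d k h (*-cancelˡ-< 2 h (2 ^ k) q<2^[1+k]) X
  map (Along-join-periodic d h) (catAlong d Y Y)
... | odd  h = relax (≤-reflexive (m*n+m≡m*[1+n] 4 k)) do
  e  , Y  ← repeat d k h (*-cancelˡ-< 2 h (2 ^ k) (<-trans (n<1+n (2 * h)) q<2^[1+k])) X
  e′ , YY ← catAlong d Y Y
  map (Along-cong d (join-periodic-cons d p F)) (catAlong d (Along-wk d (e ◅◅ e′) X) (Along-join-periodic d h YY))

join-constant : ∀ d l a r c → join d l (constant a) (constant a) r c ≡ a
join-constant vertical   l a r c with r <ᵇ l
... | true  = refl
... | false = refl
join-constant horizontal l a r c with c <ᵇ l
... | true  = refl
... | false = refl

doubleConstant : ∀ d {S l t} a → Along d S l t (constant a) → Extension S 2 (λ T → Along d T (2 * l) t (constant a))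
doubleConstant d {l = l} {t} a X =
  map (λ {T} Y → subst (λ n → Along d T n t (constant a)) (n+n≡2*n l) (Along-cong d (join-constant d l a) Y))
      (catAlong d X X)

constantRectangle : ∀ {S h w} a k₁ k₂ → h < 2 ^ k₁ → w < 2 ^ k₂ → Available S 1 1 (constant a) →
                    Extension S (4 * k₂ + 4 * k₁) (λ T → Available T h w (constant a))
constantRectangle {h = h} {w} a k₁ k₂ h<2^k₁ w<2^k₂ cell = do
  _ , row ← repeat horizontal k₂ w w<2^k₂ cell
  map (Available-resize (*-identityʳ h) (*-identityʳ w)) (repeat vertical k₁ h h<2^k₁ row)

-- Bin

shiftR-+2^ : ∀ x {i k} → i ≤ k → shiftR (x + 2 ^ k) i ≡ shiftR x i + 2 ^ (k ∸ i)
shiftR-+2^ x {zero}          _         = refl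
shiftR-+2^ x {suc i} {suc k} (s≤s i≤k) =
  trans (cong (λ y → shiftR y i) (⌊m+2n/2⌋≡⌊m/2⌋+n x (2 ^ k))) (shiftR-+2^ ⌊ x /2⌋ i≤k)

shiftR-<2^ : ∀ x k → x < 2 ^ k → shiftR x k ≡ 0
shiftR-<2^ zero    zero    _         = refl
shiftR-<2^ (suc x) zero    (s≤s ())
shiftR-<2^ x       (suc k) x<2^[1+k] = shiftR-<2^ ⌊ x /2⌋ k (m<2n⇒⌊m/2⌋<n x (2 ^ k) x<2^[1+k])

-- bit x i unfolds to lowBit (shiftR x i).
lowBit : ℕ → Sym
lowBit y = if (y % 2) ≤ᵇ 0 then s0 else s1

lowBit-+-2^[1+j] : ∀ y j → lowBit (y + 2 ^ suc j) ≡ lowBit y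
lowBit-+-2^[1+j] y j = cong (λ z → if z ≤ᵇ 0 then s0 else s1)
  (trans (cong (λ z → (y + z) % 2) (*-comm 2 (2 ^ j))) ([m+kn]%n≡m%n y (2 ^ j) 2))

bit-<2^ : ∀ x k → x < 2 ^ k → bit x k ≡ s0
bit-<2^ x k x<2^k = cong lowBit (shiftR-<2^ x k x<2^k)

bit-top : ∀ x k → x < 2 ^ k → bit (x + 2 ^ k) k ≡ s1
bit-top x k x<2^k = cong lowBit (begin
  shiftR (x + 2 ^ k) k     ≡⟨ shiftR-+2^ x (≤-refl {k}) ⟩
  shiftR x k + 2 ^ (k ∸ k) ≡⟨ cong₂ (λ a b → a + 2 ^ b) (shiftR-<2^ x k x<2^k) (n∸n≡0 k) ⟩
  1                        ∎)
  where open ≡-Reasoning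

bit-+2^ : ∀ x {i k} → i < k → bit (x + 2 ^ k) i ≡ bit x i
bit-+2^ x {i} {suc k} (s≤s i≤k) = begin
  lowBit (shiftR (x + 2 ^ suc k) i)     ≡⟨ cong lowBit (shiftR-+2^ x (m≤n⇒m≤1+n i≤k)) ⟩
  lowBit (shiftR x i + 2 ^ (suc k ∸ i)) ≡⟨ cong (λ e → lowBit (shiftR x i + 2 ^ e)) (+-∸-assoc 1 i≤k) ⟩
  lowBit (shiftR x i + 2 ^ suc (k ∸ i)) ≡⟨ lowBit-+-2^[1+j] (shiftR x i) (k ∸ i) ⟩
  lowBit (shiftR x i)                   ∎
  where open ≡-Reasoning

binaryDigits : ℕ → Grid
binaryDigits k r c = bit r (k ∸ suc c)

data Halves (k : ℕ) : ℕ → Set where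
  lowHalf  : ∀ {x} → x < 2 ^ k → Halves k x
  highHalf : ∀ {x} → x < 2 ^ k → Halves k (x + 2 ^ k)

halves : ∀ k r → r < 2 ^ suc k → Halves k r
halves k r r<2^[1+k] with r <? 2 ^ k
... | yes r<2^k = lowHalf r<2^k
... | no  r≮2^k = subst (Halves k) (m∸n+n≡m (≮⇒≥ r≮2^k))
                        (highHalf (m<n+o⇒m∸n<o r (2 ^ k) {{m^n≢0 2 k}} (subst (r <_) (sym (n+n≡2*n (2 ^ k))) r<2^[1+k])))

prefixedDigits : Sym → ℕ → Grid
prefixedDigits a k = beside 1 (constant a) (binaryDigits k)

-- The leading digit splits the rows into halves; the remaining digits repeat.
binaryDigits-step : ∀ k r c → r < 2 ^ suc k → c < suc k →
                    above (2 ^ k) (prefixedDigits s0 k) (prefixedDigits s1 k) r c ≡ binaryDigits (suc k) r c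
binaryDigits-step k r c r<2^[1+k] c≤k with halves k r r<2^[1+k]
... | lowHalf r<2^k = trans (above-< (prefixedDigits s0 k) (prefixedDigits s1 k) c r<2^k) (lowRow c)
  where
  lowRow : ∀ c → prefixedDigits s0 k r c ≡ binaryDigits (suc k) r c
  lowRow zero    = sym (bit-<2^ r k r<2^k)
  lowRow (suc c) = refl
... | highHalf {x} x<2^k = begin
  above (2 ^ k) (prefixedDigits s0 k) (prefixedDigits s1 k) (x + 2 ^ k) c
    ≡⟨ above-≥ (prefixedDigits s0 k) (prefixedDigits s1 k) c (m≤n+m (2 ^ k) x) ⟩
  prefixedDigits s1 k (x + 2 ^ k ∸ 2 ^ k) c
    ≡⟨ cong (λ y → prefixedDigits s1 k y c) (m+n∸n≡m x (2 ^ k)) ⟩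
  prefixedDigits s1 k x c
    ≡⟨ highRow c c≤k ⟩
  binaryDigits (suc k) (x + 2 ^ k) c
    ∎
  where
  open ≡-Reasoning
  highRow : ∀ c → c < suc k → prefixedDigits s1 k x c ≡ binaryDigits (suc k) (x + 2 ^ k) c
  highRow zero    _         = sym (bit-top x k x<2^k)
  highRow (suc c) (s≤s c<k) = sym (bit-+2^ x (∸-suc-< c<k))
    where
    ∸-suc-< : ∀ {c k} → c < k → k ∸ suc c < k
    ∸-suc-< {c} {suc k} _ = s≤s (m∸n≤m k c)

ConstantColumns : SLP → ℕ → Set
ConstantColumns S h = ∀ a → Available S h 1 (constant a)

letters : ∀ S → Extension S 3 (λ T → ConstantColumns T 1)
letters S = do
  e₀ , cell0 ← letter S s0
  e₁ , cell1 ← letter _ s1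
  e₂ , cell$ ← letter _ s$
  pure λ where
    s0 → wk (e₁ ◅◅ e₂) cell0
    s1 → wk e₂ cell1
    s$ → cell$

doubleColumns : ∀ {S h} → ConstantColumns S h → Extension S 6 (λ T → ConstantColumns T (2 * h))
doubleColumns cols = do
  e₀ , zeros   ← doubleConstant vertical s0 (cols s0)
  e₁ , ones    ← doubleConstant vertical s1 (wk e₀ (cols s1))
  e₂ , dollars ← doubleConstant vertical s$ (wk (e₀ ◅◅ e₁) (cols s$))
  pure λ where
    s0 → wk (e₁ ◅◅ e₂) zeros
    s1 → wk e₂ ones
    s$ → dollars

record BinaryCounter (S : SLP) (k : ℕ) : Set where
  constructor counter
  field
    columns : ConstantColumns S (2 ^ k)
    digits  : Available S (2 ^ k) k (binaryDigits k)

nextDigits : ∀ {S k} → ConstantColumns S (2 ^ k) → Available S (2 ^ k) k (binaryDigits k) →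
             Extension S 6 (λ T → Available T (2 ^ suc k) (suc k) (binaryDigits (suc k)))
nextDigits {k = k} cols D = do
  e₀ , top    ← catBeside (cols s0) D
  e₁ , bottom ← catBeside (wk e₀ (cols s1)) (wk e₀ D)
  map (Available-cong (binaryDigits-step k) ∘ Available-resize (n+n≡2*n (2 ^ k)) refl) (catAbove (wk e₁ top) bottom)

binaryCounter : ∀ {S} k → ConstantColumns S 1 → Extension S (12 * k) (λ T → BinaryCounter T k)
binaryCounter zero    cells = pure (counter cells (empty (inj₂ refl)))
binaryCounter (suc k) cells = relax (≤-reflexive (m*n+m≡m*[1+n] 12 k)) do
  _  , counter cols D ← binaryCounter k cells
  e₁ , D′             ← nextDigits cols D
  e₂ , cols′          ← doubleColumns (λ a → wk e₁ (cols a))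
  pure (counter cols′ (wk e₂ D′))

bin-entry : ∀ k r c → c < suc (suc k) →
                beside 1 (constant s$) (beside k (binaryDigits k) (constant s$)) r c ≡ binEntry k r c
bin-entry k r zero    _                 = refl
bin-entry k r (suc c) (s≤s (s≤s c≤k)) with m≤n⇒m<n∨m≡n c≤k
... | inj₁ c<k  = trans (⟨⟩-< {i = c} (binaryDigits k r) (constant s$ r) c<k) (sym (if-false (<ᵇ-false (s≤s c<k))))
... | inj₂ refl = trans (⟨⟩-≥ {i = c} (binaryDigits c r) (constant s$ r) ≤-refl) (sym (if-true (<ᵇ-true (n<1+n c))))

binBlock : ∀ {S k} → ConstantColumns S (2 ^ k) → Available S (2 ^ k) k (binaryDigits k) →
           Extension S 4 (λ T → Available T (2 ^ k) (suc (suc k)) (binEntry k))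
binBlock {k = k} cols D = do
  e , D$ ← catBeside D (cols s$)
  map (Available-cong (λ r c _ → bin-entry k r c) ∘ Available-resize refl (cong suc (+-comm k 1)))
      (catBeside (wk e (cols s$)) D$)

-- ShiftBin

module ShiftBin (k : ℕ) where

  L K : ℕ
  L = suc (suc k)
  K = 2 ^ k

  SB : Grid
  SB = shiftBinEntry k

  -- SB r c unfolds to blockAt (c / L) r (c % L).
  blockAt : ℕ → Grid
  blockAt j r c = if (j ≤ᵇ r) ∧ (r <ᵇ j + K) then binEntry k (r ∸ j) c else s0

  blockAt-translate : ∀ d j r c → blockAt (d + j) (d + r) c ≡ blockAt j r c
  blockAt-translate d j r c =
    cong₂ (λ b x → if b then binEntry k x c else s0)
          (cong₂ _∧_ (≤ᵇ-+ d j r) (trans (cong (d + r <ᵇ_) (+-assoc d j K)) (<ᵇ-+ d r (j + K))))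
          ([m+n]∸[m+o]≡n∸o d r j)

  blockAt-above : ∀ {j r} c → r < j → blockAt j r c ≡ s0
  blockAt-above {j} {r} c r<j = cong (λ b → if b ∧ (r <ᵇ j + K) then binEntry k (r ∸ j) c else s0) (≤ᵇ-false r<j)

  blockAt-below : ∀ {j r} c → j + K ≤ r → blockAt j r c ≡ s0
  blockAt-below {j} {r} c j+K≤r =
    trans (cong (λ b → if (j ≤ᵇ r) ∧ b then binEntry k (r ∸ j) c else s0) (<ᵇ-false j+K≤r))
          (if-false (∧-zeroʳ (j ≤ᵇ r)))

  SB-translate : ∀ d r c → SB (d + r) (d * L + c) ≡ SB r c
  SB-translate d r c =
    trans (cong₂ (λ j c′ → blockAt j (d + r) c′) [dL+c]/L≡d+c/L [dL+c]%L≡c%L) (blockAt-translate d (c / L) r (c % L))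
    where
    [dL+c]/L≡d+c/L : (d * L + c) / L ≡ d + c / L
    [dL+c]/L≡d+c/L = trans (+-distrib-/-∣ˡ {d * L} c {L} (divides d refl)) (cong (_+ c / L) (m*n/n≡m d L))
    [dL+c]%L≡c%L : (d * L + c) % L ≡ c % L
    [dL+c]%L≡c%L = trans (cong (_% L) (+-comm (d * L) c)) ([m+kn]%n≡m%n c d L)

  span : ℕ → ℕ
  span t = 2 ^ t * L

  -- The first 2^t blocks occupy the rows below K + 2^t; blocks 2^t … 2^(t+1) - 1
  -- are the same picture moved 2^t rows down.
  upperBlocks lowerBlocks : ℕ → Grid
  upperBlocks t = above (K + 2 ^ t) SB (constant s0)
  lowerBlocks t = above (2 ^ t) (constant s0) SB

  SB-doubling : ∀ t r c → beside (span t) (upperBlocks t) (lowerBlocks t) r c ≡ SB r c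
  SB-doubling t r c with c <? span t | r <? K + 2 ^ t | r <? 2 ^ t
  ... | yes c<w | yes r<h | _ = trans (beside-< (upperBlocks t) (lowerBlocks t) r c<w) (above-< SB (constant s0) c r<h)
  ... | yes c<w | no  r≮h | _ =
    trans (beside-< (upperBlocks t) (lowerBlocks t) r c<w)
          (trans (above-≥ SB (constant s0) c (≮⇒≥ r≮h)) (sym (blockAt-below (c % L) c/L+K≤r)))
    where
    c/L+K≤r : c / L + K ≤ r
    c/L+K≤r = ≤-trans (<⇒≤ (+-monoˡ-< K (m<n*o⇒m/o<n {c} {2 ^ t} {L} c<w)))
                      (≤-trans (≤-reflexive (+-comm (2 ^ t) K)) (≮⇒≥ r≮h))
  ... | no  c≮w | _ | yes r<2^t =
    trans (beside-≥ (upperBlocks t) (lowerBlocks t) r (≮⇒≥ c≮w))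
          (trans (above-< (constant s0) SB (c ∸ span t) r<2^t) (sym (blockAt-above (c % L) r<c/L)))
    where
    r<c/L : r < c / L
    r<c/L = <-≤-trans r<2^t (≤-trans (≤-reflexive (sym (m*n/n≡m (2 ^ t) L))) (/-monoˡ-≤ L (≮⇒≥ c≮w)))
  ... | no  c≮w | _ | no  r≮2^t =
    trans (beside-≥ (upperBlocks t) (lowerBlocks t) r (≮⇒≥ c≮w))
          (trans (above-≥ (constant s0) SB (c ∸ span t) (≮⇒≥ r≮2^t))
                 (trans (sym (SB-translate (2 ^ t) (r ∸ 2 ^ t) (c ∸ span t)))
                        (cong₂ SB (m+[n∸m]≡n (≮⇒≥ r≮2^t)) (m+[n∸m]≡n (≮⇒≥ c≮w)))))

  firstBlock-entry : ∀ r c → c < L → above K (binEntry k) (constant s0) r c ≡ SB r c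
  firstBlock-entry r c c<L =
    trans (if-float (λ f → f c) (r <ᵇ K) {binEntry k r} {constant s0 (r ∸ K)})
          (sym (cong₂ (λ j c′ → blockAt j r c′) (m<n⇒m/n≡0 c<L) (m<n⇒m%n≡m c<L)))

  record Prefix (S : SLP) (t : ℕ) : Set where
    constructor prefix
    field
      blocks : Available S (K + 2 ^ t) (span t) SB
      zeros  : Available S (2 ^ t) (span t) (constant s0)

  prefixStep : ∀ {S t} → Prefix S t → Extension S 10 (λ T → Prefix T (suc t))
  prefixStep {t = t} (prefix B Z) = do
    e₀ , top    ← catAbove B Z
    e₁ , bottom ← catAbove (wk e₀ Z) (wk e₀ B)
    e₂ , B′     ← catBeside (Available-resize top-height refl (wk e₁ top)) (Available-resize bottom-height refl bottom)
    e₃ , Z₁     ← doubleConstant vertical s0 (wk (e₀ ◅◅ e₁ ◅◅ e₂) Z)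
    e₄ , Z₂     ← doubleConstant horizontal s0 Z₁
    pure (prefix (Available-resize refl span-double
                   (Available-cong (λ r c _ _ → SB-doubling t r c) (wk (e₃ ◅◅ e₄) B′)))
                 (Available-resize refl (sym (*-assoc 2 (2 ^ t) L)) Z₂))
    where
    top-height : K + 2 ^ t + 2 ^ t ≡ K + 2 ^ suc t
    top-height = trans (+-assoc K _ _) (cong (K +_) (n+n≡2*n (2 ^ t)))
    bottom-height : 2 ^ t + (K + 2 ^ t) ≡ K + 2 ^ suc t
    bottom-height = trans (+-comm (2 ^ t) (K + 2 ^ t)) top-height
    span-double : span t + span t ≡ span (suc t)
    span-double = trans (n+n≡2*n (span t)) (sym (*-assoc 2 (2 ^ t) L))

  prefixLoop : ∀ {S} t → Prefix S 0 → Extension S (10 * t) (λ T → Prefix T t)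
  prefixLoop zero    P = pure P
  prefixLoop (suc t) P = relax (≤-reflexive (m*n+m≡m*[1+n] 10 t)) do
    _ , P′ ← prefixLoop t P
    prefixStep P′

  shiftBin : ∀ {S b} → L < 2 ^ b → ConstantColumns S 1 →
             Extension S (22 * k + 4 * b + 10) (λ T → Available T (2 ^ suc k) (span k) SB)
  shiftBin {b = b} L<2^b cells = relax (≤-reflexive (total-cost k b)) do
    e₀ , counter cols D ← binaryCounter k cells
    e₁ , bin            ← binBlock cols D
    e₂ , row            ← constantRectangle s0 1 b (s≤s (s≤s z≤n)) L<2^b (wk (e₀ ◅◅ e₁) (cells s0))
    e₃ , first          ← catAbove (wk e₂ bin) row
    _  , prefix B _     ← prefixLoop k
      (prefix (Available-resize refl (sym (*-identityˡ L)) (Available-cong (λ r c _ → firstBlock-entry r c) first))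
              (Available-resize refl (sym (*-identityˡ L)) (wk e₃ row)))
    pure (Available-resize (n+n≡2*n K) refl B)
    where
    total-cost : ∀ k b → 12 * k + (4 + ((4 * b + 4 * 1) + (2 + (10 * k + 0)))) ≡ 22 * k + 4 * b + 10
    total-cost = solve-∀

-- C_{N,M}

window : ℕ → ℕ → Grid → Grid
window top h F = above top (constant s0) (above h F (constant s0))

window-entry : ∀ top h F r c → window top h F r c ≡ (if (top ≤ᵇ r) ∧ (r <ᵇ top + h) then F (r ∸ top) c else s0)
window-entry top h F r c with r <? top
... | yes r<top = trans (above-< (constant s0) (above h F (constant s0)) c r<top)
                        (sym (cong (λ b → if b ∧ (r <ᵇ top + h) then F (r ∸ top) c else s0) (≤ᵇ-false r<top)))
... | no  r≮top = begin
  window top h F r c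
    ≡⟨ above-≥ (constant s0) (above h F (constant s0)) c top≤r ⟩
  above h F (constant s0) (r ∸ top) c
    ≡⟨ if-float (λ f → f c) ((r ∸ top) <ᵇ h) {F (r ∸ top)} ⟩
  (if (r ∸ top) <ᵇ h then F (r ∸ top) c else s0)
    ≡⟨ cong (λ b → if b then F (r ∸ top) c else s0) r<ᵇtop+h ⟨
  (if r <ᵇ top + h then F (r ∸ top) c else s0)
    ≡⟨ cong (λ b → if b ∧ (r <ᵇ top + h) then F (r ∸ top) c else s0) (≤ᵇ-true top≤r) ⟨
  (if (top ≤ᵇ r) ∧ (r <ᵇ top + h) then F (r ∸ top) c else s0)
    ∎
  where
  open ≡-Reasoning
  top≤r : top ≤ r
  top≤r = ≮⇒≥ r≮top
  r<ᵇtop+h : (r <ᵇ top + h) ≡ ((r ∸ top) <ᵇ h)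
  r<ᵇtop+h = trans (cong (_<ᵇ top + h) (sym (m+[n∸m]≡n top≤r))) (<ᵇ-+ top (r ∸ top) h)

window-empty : ∀ top F r c → window top 0 F r c ≡ s0
window-empty top F r c with r <? top
... | yes r<top = above-< (constant s0) (above 0 F (constant s0)) c r<top
... | no  r≮top = above-≥ (constant s0) (above 0 F (constant s0)) c (≮⇒≥ r≮top)

placeVertically : ∀ {S H w F} kH kw top h → top + h ≤ H → H < 2 ^ kH → w < 2 ^ kw →
                  Available S 1 1 (constant s0) → Available S h w F →
                  Extension S (8 * kw + 8 * kH + 4) (λ T → Available T H w (window top h F))
placeVertically {H = H} kH kw top h top+h≤H H<2^kH w<2^kw cell X = relax (≤-reflexive (total-cost kw kH)) do
  e₀ , zerosAbove ← constantRectangle s0 kH kw (≤-<-trans (≤-trans (m≤m+n top h) top+h≤H) H<2^kH) w<2^kw cell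
  e₁ , zerosBelow ← constantRectangle s0 kH kw (≤-<-trans (m∸n≤m H (top + h)) H<2^kH) w<2^kw (wk e₀ cell)
  e₂ , middle     ← catAbove (wk (e₀ ◅◅ e₁) X) zerosBelow
  map (Available-resize stacked-height refl) (catAbove (wk (e₁ ◅◅ e₂) zerosAbove) middle)
  where
  total-cost : ∀ kw kH → (4 * kw + 4 * kH) + ((4 * kw + 4 * kH) + (2 + 2)) ≡ 8 * kw + 8 * kH + 4
  total-cost = solve-∀
  stacked-height : top + (h + (H ∸ (top + h))) ≡ H
  stacked-height = trans (sym (+-assoc top h _)) (m+[n∸m]≡n top+h≤H)

size-bound : ∀ m A B → m ≤ B → 1 ≤ B → 3 + (22 * m + 28 * suc A + 24 * suc B + 22) ≤ 123 * (A + B)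
size-bound m A B m≤B 1≤B = begin
  3 + (22 * m + 28 * suc A + 24 * suc B + 22)
    ≡⟨ expand m A B ⟩
  77 * 1 + 22 * m + 28 * A + 24 * B
    ≤⟨ +-monoˡ-≤ (24 * B) (+-monoˡ-≤ (28 * A) (+-mono-≤ (*-monoʳ-≤ 77 1≤B) (*-monoʳ-≤ 22 m≤B))) ⟩
  77 * B + 22 * B + 28 * A + 24 * B
    ≡⟨ collect A B ⟩
  28 * A + 123 * B
    ≤⟨ +-monoˡ-≤ (123 * B) (*-monoˡ-≤ A (m≤m+n 28 95)) ⟩
  123 * A + 123 * B
    ≡⟨ *-distribˡ-+ 123 A B ⟨
  123 * (A + B)
    ∎
  where
  open ≤-Reasoning
  expand : ∀ m A B → 3 + (22 * m + 28 * suc A + 24 * suc B + 22) ≡ 77 * 1 + 22 * m + 28 * A + 24 * B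
  expand = solve-∀
  collect : ∀ A B → 77 * B + 22 * B + 28 * A + 24 * B ≡ 28 * A + 123 * B
  collect = solve-∀

module Construction (N M m : ℕ) where
  open ShiftBin m

  H : ℕ
  H = 2 ^ suc m

  instance
    H≢0 : NonZero H
    H≢0 = m^n≢0 2 (suc m)

  W q₁ q₂ : ℕ
  W  = 2 ^ m * (m + 2)
  q₁ = N / H
  q₂ = (N ∸ K) / H

  span≡W : span m ≡ W
  span≡W = cong (2 ^ m *_) (+-comm 2 m)

  stripeGrid : ℕ → ℕ → Grid
  stripeGrid top q = window top (2 * K * q) (periodic vertical H SB)

  -- The right stripe of C_{N,M} starts at row K.  When N < K it is empty (q₂ = 0);
  -- starting it at N ⊓ K instead keeps it inside the N rows.
  stripeGrid-right : ∀ r c → stripeGrid (N ⊓ K) q₂ r c ≡ stripeGrid K q₂ r c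
  stripeGrid-right r c with K ≤? N
  ... | yes K≤N = cong (λ top → stripeGrid top q₂ r c) (m≥n⇒m⊓n≡n K≤N)
  ... | no  K≰N = trans (stripeGrid-empty (N ⊓ K)) (sym (stripeGrid-empty K))
    where
    2Kq₂≡0 : 2 * K * q₂ ≡ 0
    2Kq₂≡0 = trans (cong (λ x → 2 * K * (x / H)) (m≤n⇒m∸n≡0 (<⇒≤ (≰⇒> K≰N))))
                   (trans (cong (2 * K *_) (0/n≡0 H)) (*-zeroʳ (2 * K)))
    stripeGrid-empty : ∀ top → stripeGrid top q₂ r c ≡ s0
    stripeGrid-empty top = trans (cong (λ h → window top h (periodic vertical H SB) r c) 2Kq₂≡0)
                                 (window-empty top (periodic vertical H SB) r c)

  rightPart cGrid : Grid
  rightPart = beside W (stripeGrid (N ⊓ K) q₂) (constant s0)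
  cGrid     = beside W (stripeGrid 0 q₁) rightPart

  <ᵇW+W : ∀ {c} → W ≤ c → (c <ᵇ W + W) ≡ (c ∸ W <ᵇ W)
  <ᵇW+W {c} W≤c = trans (cong (_<ᵇ W + W) (sym (m+[n∸m]≡n W≤c))) (<ᵇ-+ W (c ∸ W) W)

  cGrid-entry : ∀ r c → cGrid r c ≡ cEntry N M m r c
  cGrid-entry r c with c <? W
  ... | yes c<W = begin
    cGrid r c
      ≡⟨ beside-< (stripeGrid 0 q₁) rightPart r c<W ⟩
    stripeGrid 0 q₁ r c
      ≡⟨ window-entry 0 (2 * K * q₁) (periodic vertical H SB) r c ⟩
    (if r <ᵇ 2 * K * q₁ then SB (r % H) c else s0)
      ≡⟨ if-true (<ᵇ-true c<W) ⟨
    cEntry N M m r c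
      ∎
    where open ≡-Reasoning
  ... | no  c≮W with c ∸ W <? W
  ...   | yes c∸W<W = begin
    cGrid r c
      ≡⟨ beside-≥ (stripeGrid 0 q₁) rightPart r (≮⇒≥ c≮W) ⟩
    rightPart r (c ∸ W)
      ≡⟨ beside-< (stripeGrid (N ⊓ K) q₂) (constant s0) r c∸W<W ⟩
    stripeGrid (N ⊓ K) q₂ r (c ∸ W)
      ≡⟨ stripeGrid-right r (c ∸ W) ⟩
    stripeGrid K q₂ r (c ∸ W)
      ≡⟨ window-entry K (2 * K * q₂) (periodic vertical H SB) r (c ∸ W) ⟩
    (if (K ≤ᵇ r) ∧ (r <ᵇ K + 2 * K * q₂) then SB ((r ∸ K) % H) (c ∸ W) else s0)
      ≡⟨ trans (if-false (<ᵇ-false (≮⇒≥ c≮W))) (if-true (trans (<ᵇW+W (≮⇒≥ c≮W)) (<ᵇ-true c∸W<W))) ⟨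
    cEntry N M m r c
      ∎
    where open ≡-Reasoning
  ...   | no  c∸W≮W = begin
    cGrid r c
      ≡⟨ beside-≥ (stripeGrid 0 q₁) rightPart r (≮⇒≥ c≮W) ⟩
    rightPart r (c ∸ W)
      ≡⟨ beside-≥ (stripeGrid (N ⊓ K) q₂) (constant s0) r (≮⇒≥ c∸W≮W) ⟩
    s0
      ≡⟨ trans (if-false (<ᵇ-false (≮⇒≥ c≮W))) (if-false (trans (<ᵇW+W (≮⇒≥ c≮W)) (<ᵇ-false (≮⇒≥ c∸W≮W)))) ⟨
    cEntry N M m r c
      ∎
    where open ≡-Reasoning

  stripeGrid-available : ∀ {S} top q → top + 2 * K * q ≤ N → W ≤ M →
                         Available S H W SB → Available S 1 1 (constant s0) →
                         Extension S (4 * bits N + (8 * bits M + 8 * bits N + 4)) (λ T → Available T N W (stripeGrid top q))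
  stripeGrid-available top q top+2Kq≤N W≤M sb cell = do
    e , copies ← repeat vertical (bits N) q (<2^bits q≤N) sb
    placeVertically (bits N) (bits M) top (2 * K * q) top+2Kq≤N (<2^bits ≤-refl) (<2^bits W≤M)
                    (wk e cell) (Available-resize (*-comm q H) refl copies)
    where
    q≤N : q ≤ N
    q≤N = ≤-trans (m≤n*m q H) (≤-trans (m≤n+m (2 * K * q) top) top+2Kq≤N)

  cGrid-available : ∀ {S} → W + W ≤ M → ConstantColumns S 1 →
                    Extension S (22 * m + 28 * bits N + 24 * bits M + 22) (λ T → Available T N M cGrid)
  cGrid-available W+W≤M cells = relax (≤-reflexive (total-cost m (bits N) (bits M))) do
    e₀ , sb    ← shiftBin (<2^bits (≤-trans (m≤n*m L K {{m^n≢0 2 m}}) (≤-trans (≤-reflexive span≡W) W≤M))) cells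
    e₁ , left  ← stripeGrid-available 0 q₁ (H*[x/H]≤x N) W≤M
                                      (Available-resize refl span≡W sb) (wk e₀ (cells s0))
    e₂ , right ← stripeGrid-available (N ⊓ K) q₂ right-fits W≤M
                                      (Available-resize refl span≡W (wk e₁ sb)) (wk (e₀ ◅◅ e₁) (cells s0))
    e₃ , rest  ← constantRectangle s0 (bits N) (bits M) (<2^bits ≤-refl) (<2^bits (m∸n≤m M (W + W)))
                                   (wk (e₀ ◅◅ e₁ ◅◅ e₂) (cells s0))
    e₄ , right-rest ← catBeside (wk e₃ right) rest
    map (Available-resize refl total-width) (catBeside (wk (e₂ ◅◅ e₃ ◅◅ e₄) left) right-rest)
    where
    W≤M : W ≤ M
    W≤M = ≤-trans (m≤m+n W W) W+W≤M
    H*[x/H]≤x : ∀ x → 2 * K * (x / H) ≤ x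
    H*[x/H]≤x x = ≤-trans (≤-reflexive (*-comm H (x / H))) (m/n*n≤m x H)
    right-fits : N ⊓ K + 2 * K * q₂ ≤ N
    right-fits = ≤-trans (+-monoʳ-≤ (N ⊓ K) (≤-trans (H*[x/H]≤x (N ∸ K)) (∸-monoʳ-≤ N (m⊓n≤n N K))))
                         (≤-reflexive (m+[n∸m]≡n (m⊓n≤m N K)))
    total-width : W + (W + (M ∸ (W + W))) ≡ M
    total-width = trans (sym (+-assoc W W _)) (m+[n∸m]≡n W+W≤M)
    total-cost : ∀ m bN bM →
                 (22 * m + 4 * bM + 10) + ((4 * bN + (8 * bM + 8 * bN + 4)) + ((4 * bN + (8 * bM + 8 * bN + 4))
                   + ((4 * bM + 4 * bN) + (2 + 2))))
                 ≡ 22 * m + 28 * bN + 24 * bM + 22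
    total-cost = solve-∀

  cPic-slp : 1 ≤ N → 4 ≤ M → W + W ≤ M →
             Σ ℕ λ n → Σ (Prog n) λ p → Σ (Fin n) λ s →
               Derives p s (CPic N M m) × size p ≤ 123 * (⌊log₂ N ⌋ + ⌊log₂ M ⌋)
  cPic-slp 1≤N 4≤M W+W≤M =
    extractSLP 1≤N (≤-trans (s≤s z≤n) 4≤M) (relax (size-bound m _ _ m≤⌊log₂M⌋ 1≤⌊log₂M⌋) do
      _ , cells ← letters ⟪ [] ⟫
      map (Available-cong λ r c _ _ → cGrid-entry r c) (cGrid-available W+W≤M cells))
    where
    m≤⌊log₂M⌋ : m ≤ ⌊log₂ M ⌋
    m≤⌊log₂M⌋ = subst (_≤ ⌊log₂ M ⌋) (⌊log₂[2^n]⌋≡n m)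
                  (⌊log₂⌋-mono-≤ (≤-trans (m≤m*n K L) (≤-trans (≤-reflexive span≡W) (≤-trans (m≤m+n W W) W+W≤M))))
    1≤⌊log₂M⌋ : 1 ≤ ⌊log₂ M ⌋
    1≤⌊log₂M⌋ = ⌊log₂⌋-mono-≤ {2} (≤-trans (s≤s (s≤s z≤n)) 4≤M)

lemma4p7 : Σ ℕ λ C → 0 < C × (∀ N M → 1 ≤ N → 4 ≤ M → ∀ m → IsMaxExp M m →
               Σ ℕ λ n → Σ (Prog n) λ p → Σ (Fin n) λ s →
                 Derives p s (CPic N M m) × size p ≤ C * (⌊log₂ N ⌋ + ⌊log₂ M ⌋))
lemma4p7 = 123 , z<s , λ N M 1≤N 4≤M m (W≤M/2 , _) → Construction.cPic-slp N M m 1≤N 4≤M (W+W≤M W≤M/2)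
  where
  W+W≤M : ∀ {M W} → W ≤ M / 2 → W + W ≤ M
  W+W≤M {M} W≤M/2 = ≤-trans (+-mono-≤ W≤M/2 W≤M/2)
                             (≤-trans (≤-reflexive (trans (n+n≡2*n (M / 2)) (*-comm 2 (M / 2)))) (m/n*n≤m M 2))
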